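{- Let $\mathcal{P}$ be a Wait-Only protocol. For every well-formed execution $\rho$ of $\mathcal{P}$, every $0\le j<|\rho|$ and every $q_a\in Q_A$, we have $|\mathrm{NextIdxSet}(\rho,j,q_a)|\le|Q_W|$, where $\mathrm{NextIdxSet}(\rho,j,q_a)=\{i\mid \exists e\in[1,\mathrm{nb}(\rho)]\text{ with }\rho_j(e)\in Q_W\text{ and }(\mathrm{nextState}(\rho,j,e),\mathrm{nextIdx}(\rho,j,e))=(q_a,i)\}$.
   Context: A protocol is $\mathcal{P}=(Q,\Sigma,q_{in},T)$ with finite state set $Q$, finite message set $\Sigma$, initial state $q_{in}$, and $T\subseteq Q\times(\{!!a\}_{a\in\Sigma}\cup\{?a\}_{a\in\Sigma})\times Q$ ($!!a$ broadcast, $?a$ reception); $R(q)=\{a\mid\exists q',(q,?a,q')\in T\}$. It is Wait-Only if no state has both an outgoing reception and an outgoing broadcast; $Q_W$ (waiting states) are states with an outgoing reception, $Q_A=Q\setminus Q_W$ (action states), and $q_{in}\in Q_A$. Configurations are vectors $C\in Q^n$ ($n\ge1$), initial if all entries are $q_{in}$. $C\xrightarrow{e,t}C'$ for $t=(q,!!a,q')\in T$ means $C(e)=q$, $C'(e)=q'$, and every $e'\ne e$ either has $(C(e'),?a,C'(e'))\in T$, or $a\notin R(C(e'))$ and $C'(e')=C(e')$; $C\rightarrow C'$ if this holds for some $e,t$. A finite (resp. infinite) execution is a sequence $\rho=\rho_0\rho_1\cdots\rho_\ell$ (resp. $\rho_0\rho_1\cdots$) with $\rho_0$ initial and $\rho_{i-1}\rightarrow\rho_i$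 for $i\ge1$; $|\rho|=\ell+1$ (resp. $\omega$); $\mathrm{nb}(\rho)$ is the number of processes. Fix a state $q_u\ne q_{in}$ occurring in no transition. For $\rho_j(e)\in Q_W$, $\mathrm{nextIdx}(\rho,j,e)=\min\{k\mid j\le k\le|\rho|,\ k=|\rho|\text{ or }\rho_k(e)\in Q_A\}$, and $\mathrm{nextState}(\rho,j,e)=\rho_{\mathrm{nextIdx}(\rho,j,e)}(e)$ if $\mathrm{nextIdx}(\rho,j,e)\ne|\rho|$, else $q_u$. An execution $\rho$ is well-formed if for all $0\le i<|\rho|$ and all processes $e_1,e_2$ with $\rho_i(e_1)=\rho_i(e_2)\in Q_W$ and $\mathrm{nextState}(\rho,i,e_1)=\mathrm{nextState}(\rho,i,e_2)$, we have $\rho_k(e_1)=\rho_k(e_2)$ for all $i\le k\le\mathrm{nextIdx}(\rho,i,e_1)$. -}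

module Defs where

open import Data.Nat using (ℕ; zero; suc; _≤_; _<_)
open import Data.Fin using (Fin)
open import Data.Fin.Properties using (any?)
open import Data.Bool using (Bool; true; false)
open import Data.Bool.Properties using () renaming (_≟_ to _≟B_)
open import Data.List using (List; length; filter; allFin)
open import Data.List.Relation.Unary.All using (All)
open import Data.List.Relation.Unary.Unique.Propositional using (Unique)
open import Data.Product using (Σ; ∃; ∃-syntax; _×_; _,_)
open import Data.Sum using (_⊎_)
open import Data.Unit using (⊤)
open import Data.Empty using (⊥)
open import Relation.Nullary using (¬_; Dec)
open import Relation.Binary.PropositionalEquality using (_≡_; _≢_)

-- Actions over a message set Fin m : !!a (broadcast) and ?a (reception)
data Act (m : ℕ) : Set where
  bc : Fin m → Act m
  rc : Fin m → Act m

record Protocol (k m : ℕ) : Set where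
  field
    T     : Fin k → Act m → Fin k → Bool
    qin   : Fin k
    qu    : Fin k
    qu≢qin : qu ≢ qin
    qu-src : ∀ α q → T qu α q ≡ false
    qu-tgt : ∀ q α → T q α qu ≡ false

module _ {k m : ℕ} (P : Protocol k m) where
  open Protocol P

  _∈T : (Fin k × Act m × Fin k) → Set
  _∈T (q , α , q') = T q α q' ≡ true

  InR : Fin m → Fin k → Set
  InR a q = ∃[ q' ] ((q , rc a , q') ∈T)

  InQW : Fin k → Set
  InQW q = ∃[ a ] InR a q

  InQA : Fin k → Set
  InQA q = ¬ InQW q

  InQW? : (q : Fin k) → Dec (InQW q)
  InQW? q = any? λ a → any? λ q' → T q (rc a) q' ≟B true

  cardQW : ℕ
  cardQW = length (filter InQW? (allFin k))

  WaitOnly : Set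
  WaitOnly = (∀ q → ¬ (InQW q × (∃[ a ] ∃[ q' ] ((q , bc a , q') ∈T))))
           × InQA qin

  Config : ℕ → Set
  Config n = Fin n → Fin k

  Initial : ∀ {n} → Config n → Set
  Initial C = ∀ e → C e ≡ qin

  StepBy : ∀ {n} → Config n → Fin n → Fin m → Config n → Set
  StepBy {n} C e a C' =
    ((C e , bc a , C' e) ∈T) ×
    (∀ (e' : Fin n) → e' ≢ e →
       ((C e' , rc a , C' e') ∈T) ⊎ (¬ InR a (C e') × C' e' ≡ C e'))

  Step : ∀ {n} → Config n → Config n → Set
  Step {n} C C' = ∃[ e ] ∃[ a ] StepBy C e a C'

-- Lengths of executions: |ρ| = ℓ + 1 (finite, indices 0..ℓ) or ω
data Len : Set where
  upto : ℕ → Len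
  ω    : Len

_<L_ : ℕ → Len → Set
i <L upto ℓ = i ≤ ℓ
i <L ω      = ⊤

-- An index in {0,1,...} ∪ {|ρ|}: either a position, or |ρ| itself
data Idx : Set where
  at  : ℕ → Idx
  len : Idx

module _ {k m : ℕ} (P : Protocol k m) where
  open Protocol P

  -- A (finite or infinite) execution: nb(ρ) = n ≥ 1 processes,
  -- ρ_i = cfg i for i < |ρ| (values of cfg beyond |ρ| are irrelevant)
  record Execution : Set where
    field
      n      : ℕ
      n≥1    : 1 ≤ n
      size   : Len
      cfg    : ℕ → Config P n
      init   : Initial P (cfg 0)
      steps  : ∀ i → suc i <L size → Step P (cfg i) (cfg (suc i))

  open Execution

  -- IsNextIdx ρ j e p  :  p = nextIdx(ρ,j,e)
  -- (the minimum of {k | j ≤ k ≤ |ρ|, k = |ρ| or ρ_k(e) ∈ Q_A})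
  IsNextIdx : (ρ : Execution) → ℕ → Fin (n ρ) → Idx → Set
  IsNextIdx ρ j e (at i) =
    j ≤ i × i <L size ρ × InQA P (cfg ρ i e) ×
    (∀ l → j ≤ l → l < i → InQW P (cfg ρ l e))
  IsNextIdx ρ j e len =
    ∀ l → j ≤ l → l <L size ρ → InQW P (cfg ρ l e)

  stateAt : (ρ : Execution) → Idx → Fin (n ρ) → Fin k
  stateAt ρ (at i) e = cfg ρ i e
  stateAt ρ len    e = qu

  IsNextState : (ρ : Execution) → ℕ → Fin (n ρ) → Fin k → Set
  IsNextState ρ j e q = ∃[ p ] (IsNextIdx ρ j e p × stateAt ρ p e ≡ q)

  _≤I_ : ℕ → Idx → Set
  l ≤I at i = l ≤ i
  l ≤I len  = ⊤

  WellFormed : Execution → Set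
  WellFormed ρ =
    ∀ i → i <L size ρ → ∀ (e₁ e₂ : Fin (n ρ)) →
      cfg ρ i e₁ ≡ cfg ρ i e₂ → InQW P (cfg ρ i e₁) →
      (∃[ q ] (IsNextState ρ i e₁ q × IsNextState ρ i e₂ q)) →
      ∀ p → IsNextIdx ρ i e₁ p →
      ∀ l → i ≤ l → l ≤I p → l <L size ρ → cfg ρ l e₁ ≡ cfg ρ l e₂

  InNextIdxSet : (ρ : Execution) → ℕ → Fin k → Idx → Set
  InNextIdxSet ρ j qa i =
    ∃[ e ] (InQW P (cfg ρ j e) × IsNextIdx ρ j e i × stateAt ρ i e ≡ qa)

  -- |NextIdxSet(ρ,j,q_a)| ≤ b : every duplicate-free list of members has length ≤ b
  NextIdxSetCard≤ : (ρ : Execution) → ℕ → Fin k → ℕ → Set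
  NextIdxSetCard≤ ρ j qa b =
    ∀ (xs : List Idx) → Unique xs → All (InNextIdxSet ρ j qa) xs → length xs ≤ b

{-# OPTIONS --safe #-}
-- Send each index i of NextIdxSet(ρ,j,q_a) to the waiting state ρ_j(e) of a process e
-- witnessing it. This is injective: two processes in the same waiting state at j with the
-- same next state q_a must, by well-formedness, coincide up to the next index of the first,
-- so they leave Q_W at the same index.
module Submission where

open import Defs
open import Data.Nat using (ℕ; suc; _≤_; z≤n; s≤s)
open import Data.Nat.Properties using (≤-trans; ≤-refl; <⇒≤; <-cmp; module ≤-Reasoning)
open import Data.Fin using (Fin)
open import Data.List using (List; []; _∷_; length; filter; allFin)
open import Data.List.Properties using (length-removeAt′)
open import Data.List.Relation.Unary.All as All using (All; _∷_)
open import Data.List.Relation.Unary.AllPairs using (_∷_)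
open import Data.List.Relation.Unary.Any using (here; there; index; _─_)
open import Data.List.Relation.Unary.Unique.Propositional using (Unique)
open import Data.List.Membership.Propositional using (_∈_)
open import Data.List.Membership.Propositional.Properties using (∈-filter⁺; ∈-allFin)
open import Data.Product using (Σ; ∃-syntax; _×_; _,_)
open import Data.Unit using (tt)
open import Data.Empty using (⊥-elim)
open import Relation.Binary using (tri<; tri≈; tri>)
open import Relation.Binary.PropositionalEquality using (_≡_; _≢_; refl; sym; subst)

module _ {A : Set} where

  ∈-─⁺ : ∀ {b c} {zs : List A} (b∈zs : b ∈ zs) → c ∈ zs → c ≢ b → c ∈ (zs ─ b∈zs)
  ∈-─⁺ (here refl) (here refl) c≢b = ⊥-elim (c≢b refl)
  ∈-─⁺ (here refl) (there c∈zs) c≢b = c∈zs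
  ∈-─⁺ (there b∈zs) (here c≡z) c≢b = here c≡z
  ∈-─⁺ (there b∈zs) (there c∈zs) c≢b = there (∈-─⁺ b∈zs c∈zs c≢b)

module _ {A B : Set} (R : A → B → Set) (R-injective : ∀ {a a' b} → R a b → R a' b → a ≡ a') where

  length-≤-of-injective : ∀ (xs : List A) (zs : List B) → Unique xs →
    All (λ a → ∃[ b ] (R a b × b ∈ zs)) xs → length xs ≤ length zs
  length-≤-of-injective [] zs _ _ = z≤n
  length-≤-of-injective (x ∷ xs) zs (x∉xs ∷ xs-unique) ((b , xRb , b∈zs) ∷ images) = begin
    suc (length xs)          ≤⟨ s≤s (length-≤-of-injective xs (zs ─ b∈zs) xs-unique
                                       (All.zipWith avoid-b (x∉xs , images))) ⟩
    suc (length (zs ─ b∈zs)) ≡⟨ sym (length-removeAt′ zs (index b∈zs)) ⟩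
    length zs                ∎
    where
    open ≤-Reasoning
    avoid-b : ∀ {a} → x ≢ a × ∃[ b' ] (R a b' × b' ∈ zs) → ∃[ b' ] (R a b' × b' ∈ (zs ─ b∈zs))
    avoid-b (x≢a , b' , aRb' , b'∈zs) =
      b' , aRb' , ∈-─⁺ b∈zs b'∈zs (λ { refl → x≢a (R-injective xRb aRb') })

≤-<L-trans : ∀ {l i} s → l ≤ i → i <L s → l <L s
≤-<L-trans (upto ℓ) l≤i i≤ℓ = ≤-trans l≤i i≤ℓ
≤-<L-trans ω        _   _   = tt

module _ {k m : ℕ} (P : Protocol k m) (ρ : Execution P) where
  open Execution ρ

  IsNextIdx-functional : ∀ {j e p p'} → IsNextIdx P ρ j e p → IsNextIdx P ρ j e p' → p ≡ p'
  IsNextIdx-functional {p = at i} {at i'} (j≤i , _ , active , waiting) (j≤i' , _ , active' , waiting')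
    with <-cmp i i'
  ... | tri< i<i' _ _ = ⊥-elim (active (waiting' i j≤i i<i'))
  ... | tri≈ _ refl _ = refl
  ... | tri> _ _ i'<i = ⊥-elim (active' (waiting i' j≤i' i'<i))
  IsNextIdx-functional {p = at i} {len} (j≤i , i<size , active , _) waiting =
    ⊥-elim (active (waiting i j≤i i<size))
  IsNextIdx-functional {p = len} {at i} waiting (j≤i , i<size , active , _) =
    ⊥-elim (active (waiting i j≤i i<size))
  IsNextIdx-functional {p = len} {len} _ _ = refl

  IsNextIdx-resp-agreement : ∀ {j e₁ e₂} p →
    (∀ l → j ≤ l → _≤I_ P l p → l <L size → cfg l e₁ ≡ cfg l e₂) →
    IsNextIdx P ρ j e₁ p → IsNextIdx P ρ j e₂ p
  IsNextIdx-resp-agreement (at i) agree (j≤i , i<size , active , waiting) =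
    j≤i , i<size , subst (InQA P) (agree i j≤i ≤-refl i<size) active ,
    λ l j≤l l<i →
      subst (InQW P) (agree l j≤l (<⇒≤ l<i) (≤-<L-trans size (<⇒≤ l<i) i<size)) (waiting l j≤l l<i)
  IsNextIdx-resp-agreement len agree waiting =
    λ l j≤l l<size → subst (InQW P) (agree l j≤l tt l<size) (waiting l j≤l l<size)

  nextIdx-determined-by-waitingState : WellFormed P ρ → ∀ {j} → j <L size →
    ∀ {e₁ e₂ q p₁ p₂} → cfg j e₁ ≡ cfg j e₂ → InQW P (cfg j e₁) →
    IsNextIdx P ρ j e₁ p₁ → stateAt P ρ p₁ e₁ ≡ q →
    IsNextIdx P ρ j e₂ p₂ → stateAt P ρ p₂ e₂ ≡ q → p₁ ≡ p₂
  nextIdx-determined-by-waitingState wf {j} j<size {e₁} {e₂} {q} {p₁} {p₂}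
                                     same waiting next₁ state₁ next₂ state₂ =
    IsNextIdx-functional (IsNextIdx-resp-agreement p₁ lockstep next₁) next₂
    where
    lockstep : ∀ l → j ≤ l → _≤I_ P l p₁ → l <L size → cfg l e₁ ≡ cfg l e₂
    lockstep = wf j j<size e₁ e₂ same waiting
                 (q , (p₁ , next₁ , state₁) , (p₂ , next₂ , state₂)) p₁ next₁

mainTheorem9 : ∀ {k m : ℕ} (P : Protocol k m) → WaitOnly P →
    ∀ (ρ : Execution P) → WellFormed P ρ →
    ∀ (j : ℕ) → j <L Execution.size ρ →
    ∀ (qa : Fin k) → InQA P qa →
    NextIdxSetCard≤ P ρ j qa (cardQW P)
mainTheorem9 {k} P _ ρ wf j j<size qa _ xs xs-unique members =
  length-≤-of-injective WitnessedInState injective xs (filter (InQW? P) (allFin k)) xs-unique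
    (All.map waitingStateOf members)
  where
  open Execution ρ
  WitnessedInState : Idx → Fin k → Set
  WitnessedInState i q = Σ (InNextIdxSet P ρ j qa i) λ (e , _) → cfg j e ≡ q

  injective : ∀ {i i' q} → WitnessedInState i q → WitnessedInState i' q → i ≡ i'
  injective ((e₁ , waiting , next₁ , state₁) , refl) ((e₂ , _ , next₂ , state₂) , same) =
    nextIdx-determined-by-waitingState P ρ wf j<size (sym same) waiting next₁ state₁ next₂ state₂

  waitingStateOf : ∀ {i} → InNextIdxSet P ρ j qa i →
    ∃[ q ] (WitnessedInState i q × q ∈ filter (InQW? P) (allFin k))
  waitingStateOf member@(e , waiting , _) =
    cfg j e , (member , refl) , ∈-filter⁺ (InQW? P) (∈-allFin _) waiting
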